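{- Let $d\geq 3$, let $s,k$ be positive integers (sufficiently large with respect to $d$), let $m=s^k$, $M=m^{d-1}$, and let $T$, $\mathcal{B}$, $G$ be as defined in the context. Let $\varepsilon>0$ and let $S\subset \mathcal{B}$ with $|S|\geq (1+\varepsilon)M$. Then the maximum degree of the induced subgraph $G[S]$ is at least $\frac{\varepsilon s}{|T|^2}$.
   Context: Here $\mathbb{N}=\{0,1,2,\dots\}$. For $\mathbf{t}\in\mathbb{N}^d$ and $\mathbf{p}\in\mathbb{Z}^d$, the $\mathbf{t}$-block $B_{\mathbf{t}}(\mathbf{p})$ is the half-open box $\prod_{i=1}^d [s^{\mathbf{t}(i)}\mathbf{p}(i), s^{\mathbf{t}(i)}(\mathbf{p}(i)+1))$. Let $T=\{\mathbf{t}\in\mathbb{N}^d:\sum_{i=1}^d\mathbf{t}(i)=k\}$, and let $\mathcal{B}$ be the family of all blocks $B_{\mathbf{t}}(\mathbf{p})$ with $\mathbf{t}\in T$ and $\mathbf{p}(i)\in\{0,\dots,s^{k-\mathbf{t}(i)}-1\}$ for every $i\in[d]$ (i.e. all blocks of volume $s^k$ contained in $[0,m]^d$). $G$ is the intersection graph of $\mathcal{B}$: vertex set $\mathcal{B}$, two blocks adjacent iff they have nonempty intersection.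
   Formalization: The parameter ε ranges over the positive rationals. -}

module Defs where

open import Data.Nat using (ℕ; zero; suc; _+_; _*_; _∸_; _^_; _≤_; _<_)
open import Data.Vec using (Vec; []; _∷_; lookup)
open import Data.Fin using (Fin)
open import Data.List using (List; []; _∷_; map; concatMap; upTo; length)
open import Data.List.Membership.Propositional using (_∈_)
open import Data.List.Relation.Unary.All using (All)
open import Data.List.Relation.Unary.Unique.Propositional using (Unique)
open import Data.Product using (_×_; _,_; Σ; proj₁; proj₂; ∃)
open import Relation.Binary.PropositionalEquality using (_≡_)
open import Relation.Nullary using (¬_)

vsum : ∀ {d} → Vec ℕ d → ℕ
vsum [] = 0
vsum (x ∷ v) = x + vsum v

-- T = { t ∈ ℕ^d : Σ t(i) = k }, enumerated as a list (each element exactly once)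
comps : (d k : ℕ) → List (Vec ℕ d)
comps zero zero = [] ∷ []
comps zero (suc k) = []
comps (suc d) k = concatMap (λ j → map (j ∷_) (comps d (k ∸ j))) (upTo (suc k))

sizeT : (d k : ℕ) → ℕ
sizeT d k = length (comps d k)

-- a block B_t(p) is represented by the pair (t , p)
Block : ℕ → Set
Block d = Vec ℕ d × Vec ℕ d

InFamily : (s k : ℕ) {d : ℕ} → Block d → Set
InFamily s k {d} (t , p) =
  vsum t ≡ k × ((i : Fin d) → lookup p i < s ^ (k ∸ lookup t i))

InBox : (s : ℕ) {d : ℕ} → Vec ℕ d → Block d → Set
InBox s {d} x (t , p) = (i : Fin d) →
  (s ^ lookup t i) * lookup p i ≤ lookup x i × lookup x i < (s ^ lookup t i) * suc (lookup p i)

-- two blocks have nonempty intersection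
-- (boxes with integer corners in [0,∞)^d meet iff they share a point of ℕ^d)
Intersect : (s : ℕ) {d : ℕ} → Block d → Block d → Set
Intersect s {d} b c = ∃ λ (x : Vec ℕ d) → InBox s x b × InBox s x c

Adj : (s : ℕ) {d : ℕ} → Block d → Block d → Set
Adj s b c = ¬ (b ≡ c) × Intersect s b c

DegAtLeast : (s : ℕ) {d : ℕ} → List (Block d) → Block d → ℕ → Set
DegAtLeast s {d} S v D = Σ (List (Block d)) λ N →
  Unique N × All (_∈ S) N × All (Adj s v) N × D ≤ length N

MaxDegAtLeast : (s : ℕ) {d : ℕ} → List (Block d) → ℕ → Set
MaxDegAtLeast s S D = Σ _ λ v → v ∈ S × DegAtLeast s S v D

{-# OPTIONS --safe #-}

-- Double counting over the unit cells x of [0, m)^d.  Let c(x) be the number of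
-- blocks of S containing x.  Every block has volume m, so Σ c = |S| m.  Blocks of
-- one shape tile the cube, so c ≤ |T| and |S| m ≤ m^d |T|.  Also c ≤ 1 + (number of
-- ordered pairs of distinct blocks of S containing x), and summing over x turns
-- the pairs into Σ |A ∩ B| over distinct A, B ∈ S.  Distinct blocks of one shape
-- are disjoint, while blocks of distinct shapes t ≠ u meet in at most
-- s^(Σᵢ min(tᵢ, uᵢ)) ≤ m / s cells; hence |S| m ≤ m^d + (m / s) |S| Δ.  With
-- |S| ≥ (1 + ε) m^(d-1) the two bounds give Δ ≥ ε s / |T| ≥ ε s / |T|², for all
-- s, k ≥ 1 and d ≥ 1, so no largeness assumption is needed.

module Submission where

open import Defs
open import Data.Nat using (ℕ; _+_; _*_; _∸_; _^_; _≤_; _<_)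
open import Data.List using (List; length)
open import Data.List.Relation.Unary.All using (All)
open import Data.List.Relation.Unary.Unique.Propositional using (Unique)
open import Data.Product using (Σ; _×_)

open import Level using (Level)
open import Data.Bool using (if_then_else_)
open import Data.Nat using (zero; suc; z≤n; s≤s; _⊓_; _≟_; _≤?_; _<?_; NonZero; >-nonZero; >-nonZero⁻¹)
open import Data.Nat.Properties
open import Data.List using ([]; _∷_; map; concatMap; downFrom; filter; _++_)
open import Data.List.Properties using (length-downFrom)
open import Data.Product.Properties using () renaming (≡-dec to ×-≡-dec)
open import Data.List.Membership.Propositional using (_∈_)
open import Data.List.Membership.Propositional.Properties using (∈-map⁺; ∈-concatMap⁺; ∈-upTo⁺; ∈-filter⁻)
open import Data.List.Relation.Unary.Any using (Any; here; there; any?)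
import Data.List.Relation.Unary.Any as Any
import Data.List.Relation.Unary.All as All
open import Data.List.Relation.Unary.AllPairs using (_∷_)
open import Data.List.Relation.Unary.All.Properties using (all-filter)
open import Data.List.Relation.Unary.Unique.Propositional.Properties using (filter⁺)
open import Data.List.Extrema.Nat using (argmax; argmax-all; f[xs]≤f[argmax])
open import Data.Nat.Tactic.RingSolver using (solve)
open import Relation.Nullary using (Dec; yes; no; does; ¬_; ¬?; _×-dec_; contradiction)
open import Relation.Nullary.Decidable using (map′)
open import Relation.Binary.Definitions using (DecidableEquality; tri<; tri≈; tri>)
open import Relation.Unary using (Pred; Decidable)
open import Data.Product using (_,_; proj₁; proj₂)
open import Data.Sum using (inj₁; inj₂)
open import Relation.Binary.PropositionalEquality
open import Function using (_∘_)
open import Algebra.Properties.CommutativeSemigroup +-commutativeSemigroup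
  using () renaming (interchange to +-interchange)
open import Algebra.Properties.CommutativeSemigroup *-commutativeSemigroup
  using () renaming (interchange to *-interchange)

private
  variable
    a b : Level
    A B : Set a

m*m≤m+n⇒m≤1+n : ∀ m n → m * m ≤ m + n → m ≤ 1 + n
m*m≤m+n⇒m≤1+n zero    n _  = z≤n
m*m≤m+n⇒m≤1+n (suc m) n le = s≤s (≤-trans (m≤m*n m (suc m)) (+-cancelˡ-≤ (suc m) _ _ le))

m≤m*m : ∀ m → m ≤ m * m
m≤m*m zero    = z≤n
m≤m*m (suc m) = m≤m*n (suc m) (suc m)

degree-bound-from-counts : ∀ {s σ M X D T a b} .{{_ : NonZero s}} .{{_ : NonZero σ}} .{{_ : NonZero M}} →
  X * (s * σ) ≤ s * σ * M + σ * (X * D) → X * (s * σ) ≤ s * σ * M * T →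
  (b + a) * M ≤ b * X → a * s ≤ b * D * T
degree-bound-from-counts {s} {σ} {M} {X} {D} {T} {a} {b} by-overlaps by-classes dense =
  *-cancelʳ-≤ (a * s) (b * D * T) M (+-cancelˡ-≤ (b * s * M) _ _ (begin
    b * s * M + a * s * M ≡⟨ solve (a ∷ b ∷ s ∷ M ∷ []) ⟩
    s * ((b + a) * M)     ≤⟨ *-monoʳ-≤ s dense ⟩
    s * (b * X)           ≡⟨ solve (b ∷ s ∷ X ∷ []) ⟩
    b * (X * s)           ≤⟨ *-monoʳ-≤ b X*s≤s*M+X*D ⟩
    b * (s * M + X * D)   ≡⟨ solve (b ∷ s ∷ M ∷ X ∷ D ∷ []) ⟩
    b * s * M + b * D * X ≤⟨ +-monoʳ-≤ (b * s * M) (*-monoʳ-≤ (b * D) X≤M*T) ⟩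
    b * s * M + b * D * (M * T) ≡⟨ solve (b ∷ s ∷ M ∷ D ∷ T ∷ []) ⟩
    b * s * M + b * D * T * M   ∎))
  where
  open ≤-Reasoning
  X*s≤s*M+X*D : X * s ≤ s * M + X * D
  X*s≤s*M+X*D = *-cancelʳ-≤ (X * s) (s * M + X * D) σ (begin
    X * s * σ               ≡⟨ *-assoc X s σ ⟩
    X * (s * σ)             ≤⟨ by-overlaps ⟩
    s * σ * M + σ * (X * D) ≡⟨ solve (s ∷ σ ∷ M ∷ X ∷ D ∷ []) ⟩
    (s * M + X * D) * σ     ∎)
  X≤M*T : X ≤ M * T
  X≤M*T = *-cancelʳ-≤ X (M * T) (s * σ) {{m*n≢0 s σ}}
            (≤-trans by-classes (≤-reflexive (solve (s ∷ σ ∷ M ∷ T ∷ []))))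

∑ : List A → (A → ℕ) → ℕ
∑ []       f = 0
∑ (x ∷ xs) f = f x + ∑ xs f

syntax ∑ xs (λ x → e) = ∑[ x ∈ xs ] e

module _ {f g : A → ℕ} where

  ∑-cong : ∀ xs → (∀ {x} → x ∈ xs → f x ≡ g x) → ∑ xs f ≡ ∑ xs g
  ∑-cong []       eq = refl
  ∑-cong (x ∷ xs) eq = cong₂ _+_ (eq (here refl)) (∑-cong xs (eq ∘ there))

  ∑-mono-≤ : ∀ xs → (∀ {x} → x ∈ xs → f x ≤ g x) → ∑ xs f ≤ ∑ xs g
  ∑-mono-≤ []       le = z≤n
  ∑-mono-≤ (x ∷ xs) le = +-mono-≤ (le (here refl)) (∑-mono-≤ xs (le ∘ there))

  ∑-+ : ∀ xs → ∑[ x ∈ xs ] (f x + g x) ≡ ∑ xs f + ∑ xs g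
  ∑-+ []       = refl
  ∑-+ (x ∷ xs) = trans (cong (f x + g x +_) (∑-+ xs)) (+-interchange (f x) (g x) _ _)

module _ (f : A → ℕ) where

  ∑-*ˡ : ∀ c xs → ∑[ x ∈ xs ] (c * f x) ≡ c * ∑ xs f
  ∑-*ˡ c []       = sym (*-zeroʳ c)
  ∑-*ˡ c (x ∷ xs) = trans (cong (c * f x +_) (∑-*ˡ c xs)) (sym (*-distribˡ-+ c (f x) _))

  ∑-*ʳ : ∀ c xs → ∑[ x ∈ xs ] (f x * c) ≡ ∑ xs f * c
  ∑-*ʳ c []       = refl
  ∑-*ʳ c (x ∷ xs) = trans (cong (f x * c +_) (∑-*ʳ c xs)) (sym (*-distribʳ-+ c (f x) _))

  ∑-++ : ∀ xs ys → ∑ (xs ++ ys) f ≡ ∑ xs f + ∑ ys f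
  ∑-++ []       ys = refl
  ∑-++ (x ∷ xs) ys = trans (cong (f x +_) (∑-++ xs ys)) (sym (+-assoc (f x) _ _))

  ∑-zero : ∀ {xs} → (∀ {x} → x ∈ xs → f x ≡ 0) → ∑ xs f ≡ 0
  ∑-zero {[]}     eq = refl
  ∑-zero {x ∷ xs} eq = cong₂ _+_ (eq (here refl)) (∑-zero (eq ∘ there))

  ∑-≤-member : ∀ {y xs} → y ∈ xs → f y ≤ ∑ xs f
  ∑-≤-member {xs = x ∷ xs} (here refl) = m≤m+n (f x) _
  ∑-≤-member {xs = x ∷ xs} (there y∈) = ≤-trans (∑-≤-member y∈) (m≤n+m _ (f x))

∑-const : ∀ c (xs : List A) → ∑[ x ∈ xs ] c ≡ length xs * c
∑-const c []       = refl
∑-const c (x ∷ xs) = cong (c +_) (∑-const c xs)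

length≡∑1 : (xs : List A) → length xs ≡ ∑[ x ∈ xs ] 1
length≡∑1 xs = sym (trans (∑-const 1 xs) (*-identityʳ _))

∑-bounded : ∀ {f : A → ℕ} {c} xs → (∀ {x} → x ∈ xs → f x ≤ c) → ∑ xs f ≤ length xs * c
∑-bounded {c = c} xs le = ≤-trans (∑-mono-≤ xs le) (≤-reflexive (∑-const c xs))

∑-map : (f : B → ℕ) (g : A → B) (xs : List A) → ∑ (map g xs) f ≡ ∑[ x ∈ xs ] f (g x)
∑-map f g []       = refl
∑-map f g (x ∷ xs) = cong (f (g x) +_) (∑-map f g xs)

∑-concatMap : (f : B → ℕ) (g : A → List B) (xs : List A) →
              ∑ (concatMap g xs) f ≡ ∑[ x ∈ xs ] ∑ (g x) f
∑-concatMap f g []       = refl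
∑-concatMap f g (x ∷ xs) = trans (∑-++ f (g x) _) (cong (∑ (g x) f +_) (∑-concatMap f g xs))

∑-swap : (f : A → B → ℕ) (xs : List A) (ys : List B) →
         ∑[ x ∈ xs ] ∑[ y ∈ ys ] f x y ≡ ∑[ y ∈ ys ] ∑[ x ∈ xs ] f x y
∑-swap f []       ys = sym (trans (∑-const 0 ys) (*-zeroʳ (length ys)))
∑-swap f (x ∷ xs) ys = trans (cong (∑ ys (f x) +_) (∑-swap f xs ys)) (sym (∑-+ ys))

∑-product : (f : A → ℕ) (g : B → ℕ) (xs : List A) (ys : List B) →
            ∑[ x ∈ xs ] ∑[ y ∈ ys ] (f x * g y) ≡ ∑ xs f * ∑ ys g
∑-product f g xs ys = trans (∑-cong xs (λ {x} _ → ∑-*ˡ g (f x) ys)) (∑-*ʳ f (∑ ys g) xs)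

-- Defined through does, so that 𝟙 of a map′ or of a _×-dec_ computes (see inBox?).
𝟙 : {P : Set a} → Dec P → ℕ
𝟙 P? = if does P? then 1 else 0

module _ {P : Set a} where

  𝟙≤1 : (P? : Dec P) → 𝟙 P? ≤ 1
  𝟙≤1 (yes _) = ≤-refl
  𝟙≤1 (no _)  = z≤n

  𝟙-yes : (P? : Dec P) → P → 𝟙 P? ≡ 1
  𝟙-yes (yes _) _  = refl
  𝟙-yes (no ¬p) p = contradiction p ¬p

  𝟙-no : (P? : Dec P) → ¬ P → 𝟙 P? ≡ 0
  𝟙-no (yes p) ¬p = contradiction p ¬p
  𝟙-no (no _)  _  = refl

  𝟙-⇔ : {Q : Set b} (P? : Dec P) (Q? : Dec Q) → (P → Q) → (Q → P) → 𝟙 P? ≡ 𝟙 Q?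
  𝟙-⇔ (yes _) (yes _) _   _   = refl
  𝟙-⇔ (yes p) (no ¬q) p⇒q _   = contradiction (p⇒q p) ¬q
  𝟙-⇔ (no ¬p) (yes q) _   q⇒p = contradiction (q⇒p q) ¬p
  𝟙-⇔ (no _)  (no _)  _   _   = refl

  𝟙+𝟙¬ : (P? : Dec P) → 𝟙 P? + 𝟙 (¬? P?) ≡ 1
  𝟙+𝟙¬ (yes _) = refl
  𝟙+𝟙¬ (no _)  = refl

  𝟙-× : {Q : Set b} (P? : Dec P) (Q? : Dec Q) → 𝟙 (P? ×-dec Q?) ≡ 𝟙 P? * 𝟙 Q?
  𝟙-× (yes _) Q? = sym (+-identityʳ (𝟙 Q?))
  𝟙-× (no _)  Q? = refl

module _ {P : Pred A b} (P? : Decidable P) where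

  length-filter≡∑𝟙 : ∀ xs → length (filter P? xs) ≡ ∑[ x ∈ xs ] 𝟙 (P? x)
  length-filter≡∑𝟙 []       = refl
  length-filter≡∑𝟙 (x ∷ xs) with P? x
  ... | yes _ = cong suc (length-filter≡∑𝟙 xs)
  ... | no _  = length-filter≡∑𝟙 xs

  ∑𝟙≤1 : ∀ {xs} → Unique xs → (∀ {x y} → x ∈ xs → y ∈ xs → P x → P y → x ≡ y) →
         ∑[ x ∈ xs ] 𝟙 (P? x) ≤ 1
  ∑𝟙≤1 {[]}     _            _   = z≤n
  ∑𝟙≤1 {x ∷ xs} (x≢xs ∷ xs!) one with P? x
  ... | no _   = ∑𝟙≤1 xs! (λ y∈ z∈ → one (there y∈) (there z∈))
  ... | yes px = ≤-reflexive (cong suc (∑-zero (λ y → 𝟙 (P? y)) none))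
    where
    none : ∀ {y} → y ∈ xs → 𝟙 (P? y) ≡ 0
    none y∈ = 𝟙-no (P? _) (λ py → All.lookup x≢xs y∈ (one (here refl) (there y∈) px py))

module Covering {ℓ} {R : A → B → Set ℓ} (R? : ∀ x X → Dec (R x X)) (points : List A) where

  size : B → ℕ
  size X = ∑[ x ∈ points ] 𝟙 (R? x X)

  shared : B → B → ℕ
  shared X Y = ∑[ x ∈ points ] (𝟙 (R? x X) * 𝟙 (R? x Y))

  multiplicity : List B → A → ℕ
  multiplicity S x = ∑[ X ∈ S ] 𝟙 (R? x X)

  ∑-size≡∑-multiplicity : ∀ S → ∑ S size ≡ ∑ points (multiplicity S)
  ∑-size≡∑-multiplicity S = ∑-swap (λ X x → 𝟙 (R? x X)) S points

  module _ {c} {C : Set c} (_≟_ : DecidableEquality C) (class : B → C) (T : List C)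
           {S : List B} (S! : Unique S) (class∈T : All (λ X → class X ∈ T) S)
           (separated : ∀ {x X Y} → X ∈ S → Y ∈ S → class X ≡ class Y → R x X → R x Y → X ≡ Y)
           where

    multiplicity≤classes : ∀ x → multiplicity S x ≤ length T
    multiplicity≤classes x = begin
      ∑[ X ∈ S ] 𝟙 (R? x X)                  ≤⟨ ∑-mono-≤ S (in-own-class ∘ All.lookup class∈T) ⟩
      ∑[ X ∈ S ] ∑[ t ∈ T ] 𝟙 (of-class? t X) ≡⟨ ∑-swap (λ X t → 𝟙 (of-class? t X)) S T ⟩
      ∑[ t ∈ T ] ∑[ X ∈ S ] 𝟙 (of-class? t X) ≤⟨ ∑-bounded T (λ {t} _ → ∑𝟙≤1 (of-class? t) S! at-most-one) ⟩
      length T * 1                           ≡⟨ *-identityʳ _ ⟩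
      length T                               ∎
      where
      open ≤-Reasoning
      of-class? : ∀ t X → Dec (class X ≡ t × R x X)
      of-class? t X = class X ≟ t ×-dec R? x X
      in-own-class : ∀ {X} → class X ∈ T → 𝟙 (R? x X) ≤ ∑[ t ∈ T ] 𝟙 (of-class? t X)
      in-own-class {X} c∈ = ≤-trans (≤-reflexive (sym own)) (∑-≤-member (λ t → 𝟙 (of-class? t X)) c∈)
        where
        own : 𝟙 (of-class? (class X) X) ≡ 𝟙 (R? x X)
        own = trans (𝟙-× (class X ≟ class X) (R? x X))
                    (trans (cong (_* 𝟙 (R? x X)) (𝟙-yes (class X ≟ class X) refl)) (*-identityˡ _))
      at-most-one : ∀ {t X Y} → X ∈ S → Y ∈ S → class X ≡ t × R x X → class Y ≡ t × R x Y → X ≡ Y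
      at-most-one X∈ Y∈ (refl , xX) (cY , xY) = separated X∈ Y∈ (sym cY) xX xY

  module Neighbourhood (_≟_ : DecidableEquality B) {S : List B} (S! : Unique S) where

    Neighbour : B → B → Set _
    Neighbour X Y = X ≢ Y × Any (λ x → R x X × R x Y) points

    neighbour? : ∀ X Y → Dec (Neighbour X Y)
    neighbour? X Y = ¬? (X ≟ Y) ×-dec any? (λ x → R? x X ×-dec R? x Y) points

    neighbours : B → List B
    neighbours X = filter (neighbour? X) S

    pairs : A → ℕ
    pairs x = ∑[ X ∈ S ] ∑[ Y ∈ S ] (𝟙 (¬? (X ≟ Y)) * (𝟙 (R? x X) * 𝟙 (R? x Y)))

    -- c² splits into the diagonal X = Y, which is at most c, and the pairs; so c² ≤ c + pairs.
    multiplicity≤1+pairs : ∀ x → multiplicity S x ≤ 1 + pairs x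
    multiplicity≤1+pairs x = m*m≤m+n⇒m≤1+n (multiplicity S x) (pairs x) (begin
      multiplicity S x * multiplicity S x   ≡⟨ square ⟩
      ∑[ X ∈ S ] ∑[ Y ∈ S ] (r X * r Y)      ≡⟨ ∑-cong S (λ {X} _ → ∑-cong S (λ {Y} _ → split X Y)) ⟩
      ∑[ X ∈ S ] ∑[ Y ∈ S ] (e X Y + ne X Y) ≡⟨ ∑-cong S (λ {X} _ → ∑-+ S) ⟩
      ∑[ X ∈ S ] (∑ S (e X) + ∑ S (ne X))    ≡⟨ ∑-+ S ⟩
      diagonal + pairs x                    ≤⟨ +-monoˡ-≤ (pairs x) diagonal≤multiplicity ⟩
      multiplicity S x + pairs x            ∎)
      where
      open ≤-Reasoning
      r : B → ℕ
      r X = 𝟙 (R? x X)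
      e ne : B → B → ℕ
      e  X Y = 𝟙 (X ≟ Y) * (r X * r Y)
      ne X Y = 𝟙 (¬? (X ≟ Y)) * (r X * r Y)
      diagonal : ℕ
      diagonal = ∑[ X ∈ S ] ∑ S (e X)
      square : multiplicity S x * multiplicity S x ≡ ∑[ X ∈ S ] ∑[ Y ∈ S ] (r X * r Y)
      square = trans (sym (∑-*ʳ r _ S)) (∑-cong S (λ {X} _ → sym (∑-*ˡ r (r X) S)))
      split : ∀ X Y → r X * r Y ≡ e X Y + ne X Y
      split X Y = begin-equality
        r X * r Y                                  ≡⟨ *-identityˡ _ ⟨
        1 * (r X * r Y)                            ≡⟨ cong (_* (r X * r Y)) (𝟙+𝟙¬ (X ≟ Y)) ⟨
        (𝟙 (X ≟ Y) + 𝟙 (¬? (X ≟ Y))) * (r X * r Y) ≡⟨ *-distribʳ-+ _ (𝟙 (X ≟ Y)) _ ⟩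
        e X Y + ne X Y                             ∎
      diagonal≤multiplicity : diagonal ≤ multiplicity S x
      diagonal≤multiplicity = ∑-mono-≤ S λ {X} _ → begin
        ∑[ Y ∈ S ] e X Y
          ≤⟨ ∑-mono-≤ S (λ {Y} _ → *-monoʳ-≤ (𝟙 (X ≟ Y)) (*-monoʳ-≤ (r X) (𝟙≤1 (R? x Y)))) ⟩
        ∑[ Y ∈ S ] (𝟙 (X ≟ Y) * (r X * 1))
          ≡⟨ ∑-cong S (λ {Y} _ → trans (cong (𝟙 (X ≟ Y) *_) (*-identityʳ (r X))) (*-comm _ (r X))) ⟩
        ∑[ Y ∈ S ] (r X * 𝟙 (X ≟ Y)) ≡⟨ ∑-*ˡ (λ Y → 𝟙 (X ≟ Y)) (r X) S ⟩
        r X * ∑[ Y ∈ S ] 𝟙 (X ≟ Y)   ≤⟨ *-monoʳ-≤ (r X) (∑𝟙≤1 (X ≟_) S! (λ _ _ p q → trans (sym p) q)) ⟩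
        r X * 1                      ≡⟨ *-identityʳ (r X) ⟩
        r X                          ∎

    ∑-pairs≡∑-shared : ∑ points pairs ≡ ∑[ X ∈ S ] ∑[ Y ∈ S ] (𝟙 (¬? (X ≟ Y)) * shared X Y)
    ∑-pairs≡∑-shared = begin
      ∑[ x ∈ points ] ∑[ X ∈ S ] ∑[ Y ∈ S ] term x X Y  ≡⟨ ∑-swap (λ x X → ∑ S (term x X)) points S ⟩
      ∑[ X ∈ S ] ∑[ x ∈ points ] ∑[ Y ∈ S ] term x X Y  ≡⟨ ∑-cong S (λ {X} _ → ∑-swap (λ x → term x X) points S) ⟩
      ∑[ X ∈ S ] ∑[ Y ∈ S ] ∑[ x ∈ points ] term x X Y  ≡⟨ ∑-cong S (λ {X} _ → ∑-cong S (λ {Y} _ →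
                                                            ∑-*ˡ (λ x → 𝟙 (R? x X) * 𝟙 (R? x Y)) (𝟙 (¬? (X ≟ Y))) points)) ⟩
      ∑[ X ∈ S ] ∑[ Y ∈ S ] (𝟙 (¬? (X ≟ Y)) * shared X Y) ∎
      where
      open ≡-Reasoning
      term : A → B → B → ℕ
      term x X Y = 𝟙 (¬? (X ≟ Y)) * (𝟙 (R? x X) * 𝟙 (R? x Y))

    shared≤bound*𝟙neighbour : ∀ {σ} X Y → (Neighbour X Y → shared X Y ≤ σ) →
                              𝟙 (¬? (X ≟ Y)) * shared X Y ≤ σ * 𝟙 (neighbour? X Y)
    shared≤bound*𝟙neighbour {σ} X Y bound with X ≟ Y
    ... | yes _  = z≤n
    ... | no X≢Y with any? (λ x → R? x X ×-dec R? x Y) points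
    ...   | yes meet = subst₂ _≤_ (sym (+-identityʳ _)) (sym (*-identityʳ _)) (bound (X≢Y , meet))
    ...   | no disjoint = ≤-reflexive (trans (+-identityʳ _) (trans (∑-zero _ outside) (sym (*-zeroʳ σ))))
      where
      outside : ∀ {x} → x ∈ points → 𝟙 (R? x X) * 𝟙 (R? x Y) ≡ 0
      outside {x} x∈ = trans (sym (𝟙-× (R? x X) (R? x Y)))
                             (𝟙-no (R? x X ×-dec R? x Y) (λ both → disjoint (Any.map (λ { refl → both }) x∈)))

    ∑-size≤points+∑-degree : ∀ σ → (∀ {X Y} → X ∈ S → Y ∈ S → Neighbour X Y → shared X Y ≤ σ) →
                             ∑ S size ≤ length points + σ * ∑[ X ∈ S ] length (neighbours X)
    ∑-size≤points+∑-degree σ bound = begin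
      ∑ S size                                           ≡⟨ ∑-size≡∑-multiplicity S ⟩
      ∑ points (multiplicity S)                          ≤⟨ ∑-mono-≤ points (λ {x} _ → multiplicity≤1+pairs x) ⟩
      ∑[ x ∈ points ] (1 + pairs x)                      ≡⟨ ∑-+ points ⟩
      ∑[ x ∈ points ] 1 + ∑ points pairs                 ≡⟨ cong₂ _+_ (sym (length≡∑1 points)) ∑-pairs≡∑-shared ⟩
      length points + ∑[ X ∈ S ] ∑[ Y ∈ S ] (𝟙 (¬? (X ≟ Y)) * shared X Y)
        ≤⟨ +-monoʳ-≤ (length points) (∑-mono-≤ S (λ {X} X∈ → ∑-mono-≤ S (λ {Y} Y∈ →
             shared≤bound*𝟙neighbour X Y (bound X∈ Y∈)))) ⟩
      length points + ∑[ X ∈ S ] ∑[ Y ∈ S ] (σ * 𝟙 (neighbour? X Y))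
        ≡⟨ cong (length points +_) (∑-cong S (λ {X} _ → trans (∑-*ˡ (λ Y → 𝟙 (neighbour? X Y)) σ S)
             (cong (σ *_) (sym (length-filter≡∑𝟙 (neighbour? X) S))))) ⟩
      length points + ∑[ X ∈ S ] (σ * length (neighbours X))
        ≡⟨ cong (length points +_) (∑-*ˡ (λ X → length (neighbours X)) σ S) ⟩
      length points + σ * ∑[ X ∈ S ] length (neighbours X) ∎
      where open ≤-Reasoning

-- Opened only after the ring-solver calls above: an overloaded _∷_ in their variable
-- lists makes the solve macro extremely slow.
open import Data.Vec using (Vec; []; _∷_; lookup; zipWith; tabulate)
open import Data.Vec.Properties using (tabulate∘lookup; tabulate-cong) renaming (≡-dec to Vec-≡-dec)
open import Data.Fin using (zero; suc)

grid : ℕ → (d : ℕ) → List (Vec ℕ d)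
grid n zero    = [] ∷ []
grid n (suc d) = concatMap (λ j → map (j ∷_) (grid n d)) (downFrom n)

∑-grid-suc : ∀ n d (f : Vec ℕ (suc d) → ℕ) →
             ∑ (grid n (suc d)) f ≡ ∑[ j ∈ downFrom n ] ∑[ x ∈ grid n d ] f (j ∷ x)
∑-grid-suc n d f = trans (∑-concatMap f _ (downFrom n))
                         (∑-cong (downFrom n) (λ {j} _ → ∑-map f (j ∷_) (grid n d)))

length-grid : ∀ n d → length (grid n d) ≡ n ^ d
length-grid n zero    = refl
length-grid n (suc d) = begin
  length (grid n (suc d))                     ≡⟨ length≡∑1 (grid n (suc d)) ⟩
  ∑[ y ∈ grid n (suc d) ] 1                   ≡⟨ ∑-grid-suc n d (λ _ → 1) ⟩
  ∑[ j ∈ downFrom n ] ∑[ x ∈ grid n d ] 1      ≡⟨ ∑-cong (downFrom n) (λ _ → lengthⁿᵈ) ⟩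
  ∑[ j ∈ downFrom n ] (n ^ d)                  ≡⟨ ∑-const (n ^ d) (downFrom n) ⟩
  length (downFrom n) * n ^ d                 ≡⟨ cong (_* n ^ d) (length-downFrom n) ⟩
  n ^ suc d                                   ∎
  where
  open ≡-Reasoning
  lengthⁿᵈ : ∑[ x ∈ grid n d ] 1 ≡ n ^ d
  lengthⁿᵈ = trans (sym (length≡∑1 (grid n d))) (length-grid n d)

∑𝟙[j<e] : ∀ e n → ∑[ j ∈ downFrom n ] 𝟙 (j <? e) ≡ n ⊓ e
∑𝟙[j<e] e zero    = refl
∑𝟙[j<e] e (suc n) with <-≤-connex n e
... | inj₁ n<e = trans (cong₂ _+_ (𝟙-yes (n <? e) n<e) (trans (∑𝟙[j<e] e n) (m≤n⇒m⊓n≡m (<⇒≤ n<e))))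
                       (sym (m≤n⇒m⊓n≡m n<e))
... | inj₂ e≤n = trans (cong₂ _+_ (𝟙-no (n <? e) (≤⇒≯ e≤n)) (trans (∑𝟙[j<e] e n) (m≥n⇒m⊓n≡n e≤n)))
                       (sym (m≥n⇒m⊓n≡n (m≤n⇒m≤1+n e≤n)))

𝟙[lo≤j<hi]+𝟙[j<lo] : ∀ {lo hi} → lo ≤ hi → ∀ j → 𝟙 (lo ≤? j ×-dec j <? hi) + 𝟙 (j <? lo) ≡ 𝟙 (j <? hi)
𝟙[lo≤j<hi]+𝟙[j<lo] {lo} {hi} lo≤hi j with ≤-<-connex lo j
... | inj₁ lo≤j = trans (cong₂ _+_ (𝟙-⇔ (lo ≤? j ×-dec j <? hi) (j <? hi) proj₂ (lo≤j ,_))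
                                   (𝟙-no (j <? lo) (≤⇒≯ lo≤j)))
                        (+-identityʳ _)
... | inj₂ j<lo = trans (cong₂ _+_ (𝟙-no (lo ≤? j ×-dec j <? hi) (<⇒≱ j<lo ∘ proj₁)) (𝟙-yes (j <? lo) j<lo))
                        (sym (𝟙-yes (j <? hi) (<-≤-trans j<lo lo≤hi)))

∑𝟙[lo≤j<hi] : ∀ {lo hi n} → lo ≤ hi → hi ≤ n → ∑[ j ∈ downFrom n ] 𝟙 (lo ≤? j ×-dec j <? hi) + lo ≡ hi
∑𝟙[lo≤j<hi] {lo} {hi} {n} lo≤hi hi≤n = begin
  ∑ (downFrom n) between + lo
    ≡⟨ cong (∑ (downFrom n) between +_) (trans (∑𝟙[j<e] lo n) (m≥n⇒m⊓n≡n (≤-trans lo≤hi hi≤n))) ⟨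
  ∑ (downFrom n) between + ∑[ j ∈ downFrom n ] 𝟙 (j <? lo) ≡⟨ ∑-+ (downFrom n) ⟨
  ∑[ j ∈ downFrom n ] (between j + 𝟙 (j <? lo))           ≡⟨ ∑-cong (downFrom n) (λ {j} _ → 𝟙[lo≤j<hi]+𝟙[j<lo] lo≤hi j) ⟩
  ∑[ j ∈ downFrom n ] 𝟙 (j <? hi)                          ≡⟨ ∑𝟙[j<e] hi n ⟩
  n ⊓ hi                                                  ≡⟨ m≥n⇒m⊓n≡n hi≤n ⟩
  hi                                                      ∎
  where
  open ≡-Reasoning
  between : ℕ → ℕ
  between j = 𝟙 (lo ≤? j ×-dec j <? hi)

cell? : ∀ a p j → Dec (a * p ≤ j × j < a * suc p)
cell? a p j = a * p ≤? j ×-dec j <? a * suc p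

∑𝟙-cell : ∀ a p {n} → a * suc p ≤ n → ∑[ j ∈ downFrom n ] 𝟙 (cell? a p j) ≡ a
∑𝟙-cell a p fits = +-cancelʳ-≡ (a * p) _ a
  (trans (∑𝟙[lo≤j<hi] (*-monoʳ-≤ a (n≤1+n p)) fits) (*-suc a p))

cell-unique : ∀ {a j p q} → a * p ≤ j × j < a * suc p → a * q ≤ j × j < a * suc q → p ≡ q
cell-unique {a} {j} {p} {q} (ap≤j , j<ap+a) (aq≤j , j<aq+a) with <-cmp p q
... | tri< p<q _ _ = contradiction (≤-trans (*-monoʳ-≤ a p<q) aq≤j) (<⇒≱ j<ap+a)
... | tri≈ _ p≡q _ = p≡q
... | tri> _ _ q<p = contradiction (≤-trans (*-monoʳ-≤ a q<p) ap≤j) (<⇒≱ j<aq+a)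

inBox? : ∀ s {d} (x : Vec ℕ d) (B : Block d) → Dec (InBox s x B)
inBox? s []      ([]     , [])     = yes λ ()
inBox? s (j ∷ x) (t ∷ ts , p ∷ ps) =
  map′ (λ (j∈ , x∈) → λ { zero → j∈ ; (suc i) → x∈ i }) (λ j∷x∈ → j∷x∈ zero , j∷x∈ ∘ suc)
       (cell? (s ^ t) p j ×-dec inBox? s x (ts , ps))

InBox-position-unique : ∀ s {d} {x t p q : Vec ℕ d} → InBox s x (t , p) → InBox s x (t , q) → p ≡ q
InBox-position-unique s {t = t} {p} {q} x∈p x∈q = begin
  p                   ≡⟨ tabulate∘lookup p ⟨
  tabulate (lookup p) ≡⟨ tabulate-cong (λ i → cell-unique {s ^ lookup t i} (x∈p i) (x∈q i)) ⟩
  tabulate (lookup q) ≡⟨ tabulate∘lookup q ⟩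
  q                   ∎
  where open ≡-Reasoning

Fits : (s n : ℕ) {d : ℕ} → Block d → Set
Fits s n (t , p) = ∀ i → s ^ lookup t i * suc (lookup p i) ≤ n

≤-^-⊓ : ∀ {x s t u} → x ≤ s ^ t → x ≤ s ^ u → x ≤ s ^ (t ⊓ u)
≤-^-⊓ {t = t} {u} ≤t ≤u with ⊓-sel t u
... | inj₁ t⊓u≡t rewrite t⊓u≡t = ≤t
... | inj₂ t⊓u≡u rewrite t⊓u≡u = ≤u

_⊓ᵥ_ : ∀ {d} → Vec ℕ d → Vec ℕ d → Vec ℕ d
_⊓ᵥ_ = zipWith _⊓_

module BoxCounting (s n : ℕ) where

  open module GridCovering {d} = Covering (inBox? s {d}) (grid n d) using (size; shared)

  size-box : ∀ {d} (B : Block d) → Fits s n B → size B ≡ s ^ vsum (proj₁ B)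
  size-box ([] , []) _ = refl
  size-box {suc d} (t ∷ ts , p ∷ ps) fits = begin
    size (t ∷ ts , p ∷ ps)
      ≡⟨ ∑-grid-suc n d _ ⟩
    ∑[ j ∈ downFrom n ] ∑[ x ∈ grid n d ] 𝟙 (cell j ×-dec inBox? s x B′)
      ≡⟨ ∑-cong (downFrom n) (λ {j} _ → ∑-cong (grid n d) (λ {x} _ → 𝟙-× (cell j) (inBox? s x B′))) ⟩
    ∑[ j ∈ downFrom n ] ∑[ x ∈ grid n d ] (𝟙 (cell j) * 𝟙 (inBox? s x B′))
      ≡⟨ ∑-product _ _ (downFrom n) (grid n d) ⟩
    ∑[ j ∈ downFrom n ] 𝟙 (cell j) * size B′
      ≡⟨ cong₂ _*_ (∑𝟙-cell (s ^ t) p (fits zero)) (size-box B′ (fits ∘ suc)) ⟩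
    s ^ t * s ^ vsum ts
      ≡⟨ ^-distribˡ-+-* s t (vsum ts) ⟨
    s ^ (t + vsum ts)
      ∎
    where
    open ≡-Reasoning
    B′ = (ts , ps)
    cell = cell? (s ^ t) p

  shared-box≤ : ∀ {d} (A B : Block d) → Fits s n A → Fits s n B →
                shared A B ≤ s ^ vsum (proj₁ A ⊓ᵥ proj₁ B)
  shared-box≤ ([] , []) ([] , []) _ _ = ≤-refl
  shared-box≤ {suc d} (t ∷ ts , p ∷ ps) (u ∷ us , q ∷ qs) fitsA fitsB = begin
    shared (t ∷ ts , p ∷ ps) (u ∷ us , q ∷ qs)
      ≡⟨ ∑-grid-suc n d _ ⟩
    ∑[ j ∈ downFrom n ] ∑[ x ∈ grid n d ] (𝟙 (cellA j ×-dec inBox? s x A′) * 𝟙 (cellB j ×-dec inBox? s x B′))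
      ≡⟨ ∑-cong (downFrom n) (λ {j} _ → ∑-cong (grid n d) (λ {x} _ → factor j x)) ⟩
    ∑[ j ∈ downFrom n ] ∑[ x ∈ grid n d ] (both j * (𝟙 (inBox? s x A′) * 𝟙 (inBox? s x B′)))
      ≡⟨ ∑-product both _ (downFrom n) (grid n d) ⟩
    ∑ (downFrom n) both * shared A′ B′
      ≤⟨ *-mono-≤ ∑both≤ (shared-box≤ A′ B′ (fitsA ∘ suc) (fitsB ∘ suc)) ⟩
    s ^ (t ⊓ u) * s ^ vsum (ts ⊓ᵥ us)
      ≡⟨ ^-distribˡ-+-* s (t ⊓ u) _ ⟨
    s ^ (t ⊓ u + vsum (ts ⊓ᵥ us))
      ∎
    where
    open ≤-Reasoning
    A′ = (ts , ps)
    B′ = (us , qs)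
    cellA = cell? (s ^ t) p
    cellB = cell? (s ^ u) q
    both : ℕ → ℕ
    both j = 𝟙 (cellA j) * 𝟙 (cellB j)
    factor : ∀ j x → 𝟙 (cellA j ×-dec inBox? s x A′) * 𝟙 (cellB j ×-dec inBox? s x B′) ≡
                     both j * (𝟙 (inBox? s x A′) * 𝟙 (inBox? s x B′))
    factor j x = trans (cong₂ _*_ (𝟙-× (cellA j) (inBox? s x A′)) (𝟙-× (cellB j) (inBox? s x B′)))
                       (*-interchange (𝟙 (cellA j)) (𝟙 (inBox? s x A′)) (𝟙 (cellB j)) (𝟙 (inBox? s x B′)))
    both≤A : ∀ j → both j ≤ 𝟙 (cellA j)
    both≤A j = ≤-trans (*-monoʳ-≤ (𝟙 (cellA j)) (𝟙≤1 (cellB j))) (≤-reflexive (*-identityʳ _))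
    both≤B : ∀ j → both j ≤ 𝟙 (cellB j)
    both≤B j = ≤-trans (*-monoˡ-≤ (𝟙 (cellB j)) (𝟙≤1 (cellA j))) (≤-reflexive (*-identityˡ _))
    ∑both≤ : ∑ (downFrom n) both ≤ s ^ (t ⊓ u)
    ∑both≤ = ≤-^-⊓ {s = s} {t} {u}
      (≤-trans (∑-mono-≤ (downFrom n) (λ {j} _ → both≤A j)) (≤-reflexive (∑𝟙-cell (s ^ t) p (fitsA zero))))
      (≤-trans (∑-mono-≤ (downFrom n) (λ {j} _ → both≤B j)) (≤-reflexive (∑𝟙-cell (s ^ u) q (fitsB zero))))

comps-complete : ∀ {d k} (t : Vec ℕ d) → vsum t ≡ k → t ∈ comps d k
comps-complete []               refl = here refl
comps-complete {suc d} {k} (j ∷ t) refl =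
  ∈-concatMap⁺ (λ i → map (i ∷_) (comps d (k ∸ i)))
    (Any.map (λ { refl → ∈-map⁺ (j ∷_) (comps-complete t (sym (m+n∸m≡n j (vsum t)))) })
             (∈-upTo⁺ (s≤s (m≤m+n j (vsum t)))))

vsum-⊓ᵥ≤ˡ : ∀ {d} (t u : Vec ℕ d) → vsum (t ⊓ᵥ u) ≤ vsum t
vsum-⊓ᵥ≤ˡ []      []      = z≤n
vsum-⊓ᵥ≤ˡ (a ∷ t) (b ∷ u) = +-mono-≤ (m⊓n≤m a b) (vsum-⊓ᵥ≤ˡ t u)

vsum-⊓ᵥ≤ʳ : ∀ {d} (t u : Vec ℕ d) → vsum (t ⊓ᵥ u) ≤ vsum u
vsum-⊓ᵥ≤ʳ []      []      = z≤n
vsum-⊓ᵥ≤ʳ (a ∷ t) (b ∷ u) = +-mono-≤ (m⊓n≤n a b) (vsum-⊓ᵥ≤ʳ t u)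

+-≤-≡⇒≡ : ∀ {a b c e} → a ≤ b → c ≤ e → a + c ≡ b + e → a ≡ b × c ≡ e
+-≤-≡⇒≡ {a} a≤b c≤e eq with m≤n⇒m<n∨m≡n a≤b
... | inj₁ a<b = contradiction eq (<⇒≢ (+-mono-<-≤ a<b c≤e))
... | inj₂ a≡b = a≡b , +-cancelˡ-≡ a _ _ (trans eq (cong (_+ _) (sym a≡b)))

vsum-⊓ᵥ-≡⇒≡ : ∀ {d} (t u : Vec ℕ d) → vsum (t ⊓ᵥ u) ≡ vsum t → vsum (t ⊓ᵥ u) ≡ vsum u → t ≡ u
vsum-⊓ᵥ-≡⇒≡ []      []      _   _   = refl
vsum-⊓ᵥ-≡⇒≡ (a ∷ t) (b ∷ u) ≡ˡ ≡ʳ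
  with a⊓b≡a , tˡ ← +-≤-≡⇒≡ (m⊓n≤m a b) (vsum-⊓ᵥ≤ˡ t u) ≡ˡ
     | a⊓b≡b , tʳ ← +-≤-≡⇒≡ (m⊓n≤n a b) (vsum-⊓ᵥ≤ʳ t u) ≡ʳ
  = cong₂ _∷_ (trans (sym a⊓b≡a) a⊓b≡b) (vsum-⊓ᵥ-≡⇒≡ t u tˡ tʳ)

vsum-⊓ᵥ< : ∀ {d} (t u : Vec ℕ d) → vsum t ≡ vsum u → t ≢ u → vsum (t ⊓ᵥ u) < vsum t
vsum-⊓ᵥ< t u same t≢u = ≤∧≢⇒< (vsum-⊓ᵥ≤ˡ t u) (λ eq → t≢u (vsum-⊓ᵥ-≡⇒≡ t u eq (trans eq same)))

lookup≤vsum : ∀ {d} (t : Vec ℕ d) i → lookup t i ≤ vsum t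
lookup≤vsum (a ∷ t) zero    = m≤m+n a (vsum t)
lookup≤vsum (a ∷ t) (suc i) = ≤-trans (lookup≤vsum t i) (m≤n+m (vsum t) a)

InFamily⇒Fits : ∀ s k {d} (B : Block d) → InFamily s k B → Fits s (s ^ k) B
InFamily⇒Fits s _ (t , p) (refl , p<) i = begin
  s ^ tᵢ * suc (lookup p i)      ≤⟨ *-monoʳ-≤ (s ^ tᵢ) (p< i) ⟩
  s ^ tᵢ * s ^ (vsum t ∸ tᵢ)     ≡⟨ ^-distribˡ-+-* s tᵢ _ ⟨
  s ^ (tᵢ + (vsum t ∸ tᵢ))       ≡⟨ cong (s ^_) (m+[n∸m]≡n (lookup≤vsum t i)) ⟩
  s ^ vsum t                     ∎
  where
  open ≤-Reasoning
  tᵢ = lookup t i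

_≟ᴮ_ : ∀ {d} → DecidableEquality (Block d)
_≟ᴮ_ = ×-≡-dec (Vec-≡-dec _≟_) (Vec-≡-dec _≟_)

same-shape-meeting⇒≡ : ∀ s {d} {x} {X Y : Block d} → proj₁ X ≡ proj₁ Y → InBox s x X → InBox s x Y → X ≡ Y
same-shape-meeting⇒≡ s {x = x} {t , p} {.t , q} refl x∈X x∈Y =
  cong (t ,_) (InBox-position-unique s {x = x} {t} x∈X x∈Y)

module Family {s k d : ℕ} .{{_ : NonZero s}} {S : List (Block d)}
              (S! : Unique S) (S⊆𝓑 : All (InFamily s (suc k)) S) where

  private
    m : ℕ
    m = s ^ suc k

  open BoxCounting s m
  open Covering (inBox? s) (grid m d)
  open Neighbourhood _≟ᴮ_ S!

  degree : Block d → ℕ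
  degree X = length (neighbours X)

  private
    fits : ∀ {X} → X ∈ S → Fits s m X
    fits {X} X∈ = InFamily⇒Fits s (suc k) X (All.lookup S⊆𝓑 X∈)

  ∑-size≡|S|*m : ∑ S size ≡ length S * m
  ∑-size≡|S|*m = trans (∑-cong S size≡m) (∑-const m S)
    where
    size≡m : ∀ {X} → X ∈ S → size X ≡ m
    size≡m {X} X∈ = trans (size-box X (fits X∈)) (cong (s ^_) (proj₁ (All.lookup S⊆𝓑 X∈)))

  |S|*m≤|grid|*|T| : length S * m ≤ m ^ d * sizeT d (suc k)
  |S|*m≤|grid|*|T| = begin
    length S * m                        ≡⟨ trans (sym (∑-size≡∑-multiplicity S)) ∑-size≡|S|*m ⟨
    ∑ (grid m d) (multiplicity S)        ≤⟨ ∑-bounded (grid m d) (λ {x} _ → multiplicity≤|T| x) ⟩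
    length (grid m d) * sizeT d (suc k) ≡⟨ cong (_* sizeT d (suc k)) (length-grid m d) ⟩
    m ^ d * sizeT d (suc k)             ∎
    where
    open ≤-Reasoning
    multiplicity≤|T| : ∀ x → multiplicity S x ≤ sizeT d (suc k)
    multiplicity≤|T| = multiplicity≤classes (Vec-≡-dec _≟_) proj₁ (comps d (suc k)) S!
      (All.map (λ (sum≡ , _) → comps-complete _ sum≡) S⊆𝓑) (λ {x} _ _ → same-shape-meeting⇒≡ s {x = x})

  -- Neighbours have distinct shapes, both summing to k + 1, so their coordinatewise minimum sums to at most k.
  shared≤s^k : ∀ {X Y} → X ∈ S → Y ∈ S → Neighbour X Y → shared X Y ≤ s ^ k
  shared≤s^k {X} {Y} X∈ Y∈ (X≢Y , meet) = begin
    shared X Y                    ≤⟨ shared-box≤ X Y (fits X∈) (fits Y∈) ⟩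
    s ^ vsum (proj₁ X ⊓ᵥ proj₁ Y) ≤⟨ ^-monoʳ-≤ s (≤-pred (subst (vsum (proj₁ X ⊓ᵥ proj₁ Y) <_) sumX
                                       (vsum-⊓ᵥ< (proj₁ X) (proj₁ Y) (trans sumX (sym sumY)) shapes-differ))) ⟩
    s ^ k                         ∎
    where
    open ≤-Reasoning
    sumX = proj₁ (All.lookup S⊆𝓑 X∈)
    sumY = proj₁ (All.lookup S⊆𝓑 Y∈)
    shapes-differ : proj₁ X ≢ proj₁ Y
    shapes-differ same with x , x∈X , x∈Y ← Any.satisfied meet =
      X≢Y (same-shape-meeting⇒≡ s {x = x} same x∈X x∈Y)

  |S|*m≤|grid|+s^k*∑deg : length S * m ≤ m ^ d + s ^ k * ∑ S degree
  |S|*m≤|grid|+s^k*∑deg = begin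
    length S * m                           ≡⟨ ∑-size≡|S|*m ⟨
    ∑ S size                               ≤⟨ ∑-size≤points+∑-degree (s ^ k) shared≤s^k ⟩
    length (grid m d) + s ^ k * ∑ S degree ≡⟨ cong (_+ s ^ k * ∑ S degree) (length-grid m d) ⟩
    m ^ d + s ^ k * ∑ S degree             ∎
    where open ≤-Reasoning

  degree-neighbours : ∀ X → DegAtLeast s S X (degree X)
  degree-neighbours X =
    neighbours X , filter⁺ (neighbour? X) S! , All.tabulate (proj₁ ∘ ∈-filter⁻ (neighbour? X)) ,
    All.map Neighbour⇒Adj (all-filter (neighbour? X) S) , ≤-refl
    where
    Neighbour⇒Adj : ∀ {Y} → Neighbour X Y → Adj s X Y
    Neighbour⇒Adj (X≢Y , meet) = X≢Y , Any.satisfied meet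

maximal-element : (f : A → ℕ) (xs : List A) → 0 < length xs →
                  Σ A λ v → v ∈ xs × All (λ x → f x ≤ f v) xs
maximal-element f (x ∷ xs) _ =
  argmax f x (x ∷ xs) , argmax-all f (here refl) (All.tabulate (λ x∈ → x∈)) , f[xs]≤f[argmax] x (x ∷ xs)

max-degree-bound : ∀ {s k d} .{{_ : NonZero s}} {S : List (Block (suc d))} →
                   Unique S → All (InFamily s (suc k)) S → ∀ a b → 0 < a →
                   (b + a) * (s ^ suc k) ^ d ≤ b * length S →
                   Σ ℕ λ D → MaxDegAtLeast s S D × a * s ≤ b * D * sizeT (suc d) (suc k)
max-degree-bound {s} {k} {d} {S} S! S⊆𝓑 a b a>0 dense =
  let v , v∈S , v-max = maximal-element degree S nonempty
      ∑degree≤|S|*Δ = ∑-bounded {f = degree} S (All.lookup v-max)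
  in degree v , (v , v∈S , degree-neighbours v) ,
     degree-bound-from-counts {s} {s ^ k} {M} {length S} {degree v} {sizeT (suc d) (suc k)} {a} {b}
       (≤-trans |S|*m≤|grid|+s^k*∑deg (+-monoʳ-≤ (s ^ suc k * M) (*-monoʳ-≤ (s ^ k) ∑degree≤|S|*Δ)))
       |S|*m≤|grid|*|T| dense
  where
  open Family S! S⊆𝓑
  M = (s ^ suc k) ^ d
  instance
    s^k≢0 : NonZero (s ^ k)
    s^k≢0 = m^n≢0 s k
    M≢0 : NonZero M
    M≢0 = m^n≢0 (s ^ suc k) d {{m^n≢0 s (suc k)}}
    b+a≢0 : NonZero (b + a)
    b+a≢0 = >-nonZero (≤-trans a>0 (m≤n+m a b))
  nonempty : 0 < length S
  nonempty = >-nonZero⁻¹ (length S) {{m*n≢0⇒n≢0 b {{>-nonZero (<-≤-trans [b+a]*M>0 dense)}}}}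
    where [b+a]*M>0 = >-nonZero⁻¹ ((b + a) * M) {{m*n≢0 (b + a) M}}

lemma5 : (d : ℕ) → 3 ≤ d →
    Σ ℕ λ N → (s k : ℕ) → 0 < s → 0 < k → N ≤ s → N ≤ k →
    (S : List (Block d)) → Unique S → All (InFamily s k) S →
    (a b : ℕ) → 0 < a → 0 < b →
    (b + a) * ((s ^ k) ^ (d ∸ 1)) ≤ b * length S →
    Σ ℕ λ D → MaxDegAtLeast s S D × a * s ≤ b * D * (sizeT d k * sizeT d k)
lemma5 (suc d) _ = 0 , λ where
  s (suc k) s>0 _ _ _ S S! S⊆𝓑 a b a>0 _ dense →
    let D , maxdeg , bound = max-degree-bound {{>-nonZero s>0}} S! S⊆𝓑 a b a>0 dense
    in D , maxdeg , ≤-trans bound (*-monoʳ-≤ (b * D) (m≤m*m (sizeT (suc d) (suc k))))
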